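{- For all integers $n\geq 4$ and $k\geq 1$ with $2k<n$, there is no subset $A\subset V(P(n,k))$ with $|A|=n$ such that the number of edges of $P(n,k)$ joining a vertex of $A$ to a vertex of $V(P(n,k))\setminus A$ equals $3$.
   Context: For $n \geq 3$, $k \geq 1$ with $2k<n$, the generalized Petersen graph $P(n,k)$ has vertex set $\{u_i, v_i : i=0,1,\dots,n-1\}$ (so $2n$ vertices) and edge set $\{u_iu_{i+1},\ u_iv_i,\ v_iv_{i+k} : i=0,\dots,n-1\}$, subscripts read modulo $n$. -}

module Defs where

open import Data.Nat using (ℕ; zero; suc; _+_; _*_; _<_; NonZero)
open import Data.Nat.DivMod using (_%_; m%n<n)
open import Data.Fin using (Fin; toℕ; fromℕ<)
open import Data.Bool using (Bool; true; false; _xor_)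
open import Data.Product using (_×_; _,_)
open import Data.List using (List; []; _∷_; map; concatMap; length; filter; allFin)
open import Relation.Binary.PropositionalEquality using (_≡_)
open import Data.Bool.Properties using (T?)

-- Vertices of the generalized Petersen graph P(n,k):
-- outer vertices u_i and inner vertices v_i, for i : Fin n.
data Vertex (n : ℕ) : Set where
  u : Fin n → Vertex n
  v : Fin n → Vertex n

_⊕_ : {n : ℕ} → {{NonZero n}} → Fin n → ℕ → Fin n
_⊕_ {n} i j = fromℕ< (m%n<n (toℕ i + j) n)

-- The edge list of P(n,k): for each i, the edges u_i u_{i+1}, u_i v_i, v_i v_{i+k}.
-- (For n ≥ 3 and 2k < n these 3n edges are pairwise distinct, so this list is
--  exactly the edge set of P(n,k).)
edges : (n k : ℕ) → {{NonZero n}} → List (Vertex n × Vertex n)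
edges n k = concatMap (λ i → (u i , u (i ⊕ 1)) ∷ (u i , v i) ∷ (v i , v (i ⊕ k)) ∷ [])
                      (allFin n)

vertices : (n : ℕ) → List (Vertex n)
vertices n = map u (allFin n) Data.List.++ map v (allFin n)

Subset : ℕ → Set
Subset n = Vertex n → Bool

card : {n : ℕ} → Subset n → ℕ
card {n} A = length (filter (λ x → T? (A x)) (vertices n))

cutSize : (n k : ℕ) → {{NonZero n}} → Subset n → ℕ
cutSize n k A = length (filter (λ e → T? (A (Data.Product.proj₁ e) xor A (Data.Product.proj₂ e))) (edges n k))

-- Read A as two n-periodic 0/1 sequences, a on the outer and b on the inner
-- cycle; the cut edges are then X outer, Y spoke and Z inner ones, and X, Y, Z are
-- Hamming distances between a, b and their rotations.  A sequence and its rotation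
-- have the same weight, so X and Z are even.  If X = 0 then a is constant, and
-- |A| = n forces every spoke into the cut, Y = n ≥ 4; hence X = 2, Y = 1, Z = 0.
-- Then b is k-periodic, and the number T of changes of b along one n-period is
-- even, nonzero (b is not constant either) and at most Y + X + Y = 4 by the
-- triangle inequality.  Counting the changes of b over nk consecutive positions in
-- two ways gives kT = nU; as 2k < n this forces U = 1, so n = kT is even, whereas
-- n = |A| = Y + 2·#{j : a_j = b_j = 1} is odd.
module Submission where

open import Defs
open import Data.Nat using (ℕ; zero; suc; _+_; _*_; _≤_; _<_; z≤n; s≤s; NonZero)
open import Data.Nat.Properties
open import Algebra.Properties.CommutativeSemigroup +-commutativeSemigroup using (interchange; x∙yz≈y∙xz)
open import Data.Nat.DivMod using (_%_; _/_; m%n<n; [m+n]%n≡m%n; m<n⇒m%n≡m; m≡m%n+[m/n]*n)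
open import Data.Nat.Divisibility using (_∣_; divides; n∣m⇒m%n≡0; ∣m+n∣m⇒∣n; m∣m*n; ∣n⇒∣m*n)
open import Data.Fin as Fin using (Fin; toℕ; fromℕ<)
open import Data.Fin.Properties using (fromℕ<-toℕ; fromℕ<-cong; toℕ<n)
open import Data.Bool using (Bool; true; false; _xor_; _∧_)
open import Data.Bool.Properties using (T?; xor-comm)
open import Data.List using (List; []; _∷_; _++_; map; length; filter; tabulate; concat; allFin)
open import Data.List.Properties using (filter-++; length-++; map-tabulate)
open import Data.Nat.ListAction using (sum)
open import Data.Product using (_×_; _,_; proj₁; proj₂)
open import Data.Empty using (⊥; ⊥-elim)
open import Function using (_∘_; id)
open import Relation.Nullary using (¬_)
open import Relation.Binary.PropositionalEquality
  using (_≡_; _≢_; _≗_; refl; sym; trans; cong; cong₂; subst; module ≡-Reasoning)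

private
  variable
    X : Set
    n : ℕ

∑ : ℕ → (ℕ → ℕ) → ℕ
∑ zero    f = 0
∑ (suc m) f = f 0 + ∑ m (f ∘ suc)

syntax ∑ m (λ j → e) = ∑[ j < m ] e

∑-cong< : ∀ m {f g : ℕ → ℕ} → (∀ {j} → j < m → f j ≡ g j) → ∑ m f ≡ ∑ m g
∑-cong< zero    eq = refl
∑-cong< (suc m) eq = cong₂ _+_ (eq (s≤s z≤n)) (∑-cong< m (eq ∘ s≤s))

∑-cong : ∀ m {f g : ℕ → ℕ} → f ≗ g → ∑ m f ≡ ∑ m g
∑-cong m eq = ∑-cong< m (λ {j} _ → eq j)

∑-const : ∀ m c → ∑[ _ < m ] c ≡ m * c
∑-const zero    c = refl
∑-const (suc m) c = cong (c +_) (∑-const m c)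

∑-distrib-+ : ∀ m (f g : ℕ → ℕ) → ∑[ j < m ] (f j + g j) ≡ ∑ m f + ∑ m g
∑-distrib-+ zero    f g = refl
∑-distrib-+ (suc m) f g =
  trans (cong (f 0 + g 0 +_) (∑-distrib-+ m (f ∘ suc) (g ∘ suc))) (interchange (f 0) (g 0) _ _)

∑-distribˡ-* : ∀ m c (f : ℕ → ℕ) → ∑[ j < m ] (c * f j) ≡ c * ∑ m f
∑-distribˡ-* zero    c f = sym (*-zeroʳ c)
∑-distribˡ-* (suc m) c f = trans (cong (c * f 0 +_) (∑-distribˡ-* m c _)) (sym (*-distribˡ-+ c (f 0) _))

∑-mono-≤ : ∀ m {f g : ℕ → ℕ} → (∀ j → f j ≤ g j) → ∑ m f ≤ ∑ m g
∑-mono-≤ zero    le = z≤n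
∑-mono-≤ (suc m) le = +-mono-≤ (le 0) (∑-mono-≤ m (le ∘ suc))

∑≡0⇒≡0 : ∀ m (f : ℕ → ℕ) → ∑ m f ≡ 0 → ∀ {j} → j < m → f j ≡ 0
∑≡0⇒≡0 (suc m) f eq {zero}  _         = m+n≡0⇒m≡0 (f 0) eq
∑≡0⇒≡0 (suc m) f eq {suc j} (s≤s j<m) = ∑≡0⇒≡0 m (f ∘ suc) (m+n≡0⇒n≡0 (f 0) eq) j<m

rotate : ℕ → (ℕ → X) → ℕ → X
rotate m f j = f (m + j)

∑-+ : ∀ m r (f : ℕ → ℕ) → ∑ (m + r) f ≡ ∑ m f + ∑ r (rotate m f)
∑-+ zero    r f = refl
∑-+ (suc m) r f = trans (cong (f 0 +_) (∑-+ m r (f ∘ suc))) (sym (+-assoc (f 0) _ _))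

Periodic : ℕ → (ℕ → X) → Set
Periodic n f = rotate n f ≗ f

rotate-periodic : ∀ m {f : ℕ → X} → Periodic n f → Periodic n (rotate m f)
rotate-periodic {n = n} m {f} per j = trans (cong f (x∙yz≈y∙xz m n j)) (per (m + j))

periodic-*+ : {f : ℕ → X} → Periodic n f → ∀ q r → f (q * n + r) ≡ f r
periodic-*+                 per zero    r = refl
periodic-*+ {n = n} {f = f} per (suc q) r =
  trans (cong f (+-assoc n (q * n) r)) (trans (per (q * n + r)) (periodic-*+ per q r))

periodic-% : .{{_ : NonZero n}} {f : ℕ → X} → Periodic n f → ∀ j → f j ≡ f (j % n)
periodic-% {n = n} {f = f} per j =
  trans (cong f (trans (m≡m%n+[m/n]*n j n) (+-comm (j % n) _))) (periodic-*+ per (j / n) (j % n))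

periodic-≗ : .{{_ : NonZero n}} {f g : ℕ → X} → Periodic n f → Periodic n g →
             (∀ {j} → j < n → f j ≡ g j) → f ≗ g
periodic-≗ {n = n} pf pg eq j =
  trans (periodic-% pf j) (trans (eq (m%n<n j n)) (sym (periodic-% pg j)))

∑-rotate : ∀ n m {f : ℕ → ℕ} → Periodic n f → ∑ n (rotate m f) ≡ ∑ n f
∑-rotate n m {f} per = +-cancelˡ-≡ (∑ m f) _ _ (begin
  ∑ m f + ∑ n (rotate m f)   ≡⟨ ∑-+ m n f ⟨
  ∑ (m + n) f                ≡⟨ cong (λ l → ∑ l f) (+-comm m n) ⟩
  ∑ (n + m) f                ≡⟨ ∑-+ n m f ⟩
  ∑ n f + ∑ m (rotate n f)   ≡⟨ cong (∑ n f +_) (∑-cong m per) ⟩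
  ∑ n f + ∑ m f              ≡⟨ +-comm (∑ n f) (∑ m f) ⟩
  ∑ m f + ∑ n f              ∎)
  where open ≡-Reasoning

∑-periods : ∀ q n {f : ℕ → ℕ} → Periodic n f → ∑ (q * n) f ≡ q * ∑ n f
∑-periods zero    n per = refl
∑-periods (suc q) n {f} per =
  trans (∑-+ n (q * n) f) (cong (∑ n f +_) (trans (∑-cong (q * n) per) (∑-periods q n per)))

∑-two-periods : ∀ n k {f : ℕ → ℕ} → Periodic n f → Periodic k f → k * ∑ n f ≡ n * ∑ k f
∑-two-periods n k {f} pn pk = begin
  k * ∑ n f   ≡⟨ ∑-periods k n pn ⟨
  ∑ (k * n) f ≡⟨ cong (λ l → ∑ l f) (*-comm k n) ⟩
  ∑ (n * k) f ≡⟨ ∑-periods n k pk ⟩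
  n * ∑ k f   ∎
  where open ≡-Reasoning

bit : Bool → ℕ
bit true  = 1
bit false = 0

bit-xor+2*bit-∧ : ∀ x y → bit (x xor y) + 2 * bit (x ∧ y) ≡ bit x + bit y
bit-xor+2*bit-∧ true  true  = refl
bit-xor+2*bit-∧ true  false = refl
bit-xor+2*bit-∧ false true  = refl
bit-xor+2*bit-∧ false false = refl

bit-xor-triangle : ∀ x y z → bit (x xor z) ≤ bit (x xor y) + bit (y xor z)
bit-xor-triangle true  true  true  = z≤n
bit-xor-triangle true  true  false = s≤s z≤n
bit-xor-triangle true  false true  = z≤n
bit-xor-triangle true  false false = s≤s z≤n
bit-xor-triangle false true  true  = s≤s z≤n
bit-xor-triangle false true  false = z≤n
bit-xor-triangle false false true  = s≤s z≤n
bit-xor-triangle false false false = z≤n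

bit-xor≡0⇒≡ : ∀ x y → bit (x xor y) ≡ 0 → x ≡ y
bit-xor≡0⇒≡ true  true  _ = refl
bit-xor≡0⇒≡ false false _ = refl

weight : ℕ → (ℕ → Bool) → ℕ
weight n c = ∑[ j < n ] bit (c j)

distance : ℕ → (ℕ → Bool) → (ℕ → Bool) → ℕ
distance n c d = ∑[ j < n ] bit (c j xor d j)

common : ℕ → (ℕ → Bool) → (ℕ → Bool) → ℕ
common n c d = ∑[ j < n ] bit (c j ∧ d j)

distance+2*common : ∀ n c d → distance n c d + 2 * common n c d ≡ weight n c + weight n d
distance+2*common n c d = begin
  distance n c d + 2 * common n c d
    ≡⟨ cong (distance n c d +_) (∑-distribˡ-* n 2 _) ⟨
  distance n c d + ∑[ j < n ] (2 * bit (c j ∧ d j))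
    ≡⟨ ∑-distrib-+ n _ _ ⟨
  ∑[ j < n ] (bit (c j xor d j) + 2 * bit (c j ∧ d j))
    ≡⟨ ∑-cong n (λ j → bit-xor+2*bit-∧ (c j) (d j)) ⟩
  ∑[ j < n ] (bit (c j) + bit (d j))
    ≡⟨ ∑-distrib-+ n _ _ ⟩
  weight n c + weight n d
    ∎
  where open ≡-Reasoning

distance-sym : ∀ n c d → distance n c d ≡ distance n d c
distance-sym n c d = ∑-cong n (λ j → cong bit (xor-comm (c j) (d j)))

distance-triangle : ∀ n c d e → distance n c e ≤ distance n c d + distance n d e
distance-triangle n c d e = ≤-trans (∑-mono-≤ n (λ j → bit-xor-triangle (c j) (d j) (e j)))
                                    (≤-reflexive (∑-distrib-+ n _ _))

distance≡0⇒≡ : ∀ n c d → distance n c d ≡ 0 → ∀ {j} → j < n → c j ≡ d j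
distance≡0⇒≡ n c d eq j<n = bit-xor≡0⇒≡ _ _ (∑≡0⇒≡0 n _ eq j<n)

distance-rotate-1≡0⇒constant : ∀ n c → distance n c (rotate 1 c) ≡ 0 → ∀ {j} → j < n → c j ≡ c 0
distance-rotate-1≡0⇒constant n c eq {zero}  _      = refl
distance-rotate-1≡0⇒constant n c eq {suc j} 1+j<n =
  trans (sym (distance≡0⇒≡ n c (rotate 1 c) eq j<n)) (distance-rotate-1≡0⇒constant n c eq j<n)
  where
  j<n : j < n
  j<n = <-trans (n<1+n j) 1+j<n

mismatch-periodic : {c d : ℕ → Bool} → Periodic n c → Periodic n d →
                      Periodic n (λ j → bit (c j xor d j))
mismatch-periodic pc pd j = cong₂ (λ x y → bit (x xor y)) (pc j) (pd j)

distance-rotate : ∀ n m {c d} → Periodic n c → Periodic n d →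
                  distance n (rotate m c) (rotate m d) ≡ distance n c d
distance-rotate n m pc pd = ∑-rotate n m (mismatch-periodic pc pd)

distance-rotate-even : ∀ n m {c} → Periodic n c → 2 ∣ distance n c (rotate m c)
distance-rotate-even n m {c} pc = ∣m+n∣m⇒∣n even (m∣m*n (common n c (rotate m c)))
  where
  open ≡-Reasoning
  even : 2 ∣ 2 * common n c (rotate m c) + distance n c (rotate m c)
  even = divides (weight n c) (begin
    2 * common n c (rotate m c) + distance n c (rotate m c)
      ≡⟨ +-comm _ (distance n c (rotate m c)) ⟩
    distance n c (rotate m c) + 2 * common n c (rotate m c)
      ≡⟨ distance+2*common n c (rotate m c) ⟩
    weight n c + weight n (rotate m c)
      ≡⟨ cong (weight n c +_) (∑-rotate n m (cong bit ∘ pc)) ⟩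
    weight n c + weight n c
      ≡⟨ cong (weight n c +_) (+-identityʳ _) ⟨
    2 * weight n c
      ≡⟨ *-comm 2 (weight n c) ⟩
    weight n c * 2
      ∎)

weight-constant : ∀ n c x → (∀ {j} → j < n → c j ≡ x) → weight n c ≡ n * bit x
weight-constant n c x eq = trans (∑-cong< n (cong bit ∘ eq)) (∑-const n (bit x))

distance≡weight+weight : ∀ n c d → common n c d ≡ 0 → distance n c d ≡ weight n c + weight n d
distance≡weight+weight n c d eq =
  trans (sym (+-identityʳ _)) (trans (cong (λ t → distance n c d + 2 * t) (sym eq)) (distance+2*common n c d))

constant⇒distance≡n : ∀ n c d x → (∀ {j} → j < n → c j ≡ x) →
                    weight n c + weight n d ≡ n → distance n c d ≡ n
constant⇒distance≡n n c d false eq weights≡n = trans (distance≡weight+weight n c d no-common) weights≡n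
  where
  no-common : common n c d ≡ 0
  no-common = trans (weight-constant n (λ j → c j ∧ d j) false (cong (_∧ _) ∘ eq)) (*-zeroʳ n)
constant⇒distance≡n n c d true eq weights≡n = trans (distance≡weight+weight n c d no-common) weights≡n
  where
  weight-c≡n : weight n c ≡ n
  weight-c≡n = trans (weight-constant n c true eq) (*-identityʳ n)
  weight-d≡0 : weight n d ≡ 0
  weight-d≡0 = +-cancelˡ-≡ n _ 0
    (trans (cong (_+ weight n d) (sym weight-c≡n)) (trans weights≡n (sym (+-identityʳ n))))
  no-common : common n c d ≡ 0
  no-common = trans (∑-cong< n (λ j<n → cong (λ x → bit (x ∧ d _)) (eq j<n))) weight-d≡0

module _ (P : X → Bool) where

  count : List X → ℕ
  count xs = length (filter (λ x → T? (P x)) xs)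

  count-∷ : ∀ x xs → count (x ∷ xs) ≡ bit (P x) + count xs
  count-∷ x xs with P x
  ... | true  = refl
  ... | false = refl

  count≡sum : ∀ xs → count xs ≡ sum (map (bit ∘ P) xs)
  count≡sum []       = refl
  count≡sum (x ∷ xs) = trans (count-∷ x xs) (cong (bit (P x) +_) (count≡sum xs))

  count-++ : ∀ xs ys → count (xs ++ ys) ≡ count xs + count ys
  count-++ xs ys =
    trans (cong length (filter-++ (λ x → T? (P x)) xs ys)) (length-++ (filter (λ x → T? (P x)) xs))

  count-tabulate : ∀ m (g : Fin m → X) (e : ℕ → ℕ) →
                   (∀ i → bit (P (g i)) ≡ e (toℕ i)) → count (tabulate g) ≡ ∑ m e
  count-tabulate zero    g e eq = refl
  count-tabulate (suc m) g e eq =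
    trans (count-∷ (g Fin.zero) _)
          (cong₂ _+_ (eq Fin.zero) (count-tabulate m (g ∘ Fin.suc) (e ∘ suc) (eq ∘ Fin.suc)))

  count-concat-tabulate : ∀ m (h : Fin m → List X) (e : ℕ → ℕ) →
                          (∀ i → count (h i) ≡ e (toℕ i)) → count (concat (tabulate h)) ≡ ∑ m e
  count-concat-tabulate zero    h e eq = refl
  count-concat-tabulate (suc m) h e eq =
    trans (count-++ (h Fin.zero) _)
          (cong₂ _+_ (eq Fin.zero) (count-concat-tabulate m (h ∘ Fin.suc) (e ∘ suc) (eq ∘ Fin.suc)))

2∤1 : ¬ 2 ∣ 1
2∤1 2∣1 with n∣m⇒m%n≡0 1 2 2∣1
... | ()

2∤3 : ¬ 2 ∣ 3
2∤3 2∣3 with n∣m⇒m%n≡0 3 2 2∣3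
... | ()

even-even-cut-of-size-3 : ∀ x y z → 2 ∣ x → 2 ∣ z → x ≢ 0 → x + (y + z) ≡ 3 →
                          x ≡ 2 × y ≡ 1 × z ≡ 0
even-even-cut-of-size-3 0 _ _ _   _   x≢0 _ = ⊥-elim (x≢0 refl)
even-even-cut-of-size-3 1 _ _ 2∣1 _   _   _ = ⊥-elim (2∤1 2∣1)
even-even-cut-of-size-3 3 _ _ 2∣3 _   _   _ = ⊥-elim (2∤3 2∣3)
even-even-cut-of-size-3 2 1 0 _   _   _   _ = refl , refl , refl
even-even-cut-of-size-3 2 0 1 _   2∣1 _   _ = ⊥-elim (2∤1 2∣1)
even-even-cut-of-size-3 2 0 0 _   _   _   ()
even-even-cut-of-size-3 2 0 (suc (suc _)) _ _ _ ()
even-even-cut-of-size-3 2 1 (suc _)       _ _ _ ()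
even-even-cut-of-size-3 2 (suc (suc _)) _ _ _ _ ()
even-even-cut-of-size-3 (suc (suc (suc (suc _)))) _ _ _ _ _ ()

k*t≢n*l : ∀ n k t l → 1 ≤ k → 2 * k < n → ¬ 2 ∣ n → 2 ∣ t → 0 < t → t ≤ 4 → k * t ≢ n * l
k*t≢n*l n k t 0 1≤k _ _ _ 0<t _ eq with ≤-trans (*-mono-≤ 1≤k 0<t) (≤-reflexive (trans eq (*-zeroʳ n)))
... | ()
k*t≢n*l n k t 1 _ _ 2∤n 2∣t _ _ eq = 2∤n (subst (2 ∣_) (trans eq (*-identityʳ n)) (∣n⇒∣m*n k 2∣t))
k*t≢n*l n k t (suc (suc l)) _ 2k<n _ _ _ t≤4 eq = <-irrefl eq (begin-strict
  k * t           ≤⟨ *-monoʳ-≤ k t≤4 ⟩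
  k * 4           ≡⟨ trans (*-comm k 4) (*-assoc 2 2 k) ⟩
  2 * (2 * k)     <⟨ *-monoʳ-< 2 2k<n ⟩
  2 * n           ≡⟨ *-comm 2 n ⟩
  n * 2           ≤⟨ *-monoʳ-≤ n (s≤s (s≤s z≤n)) ⟩
  n * suc (suc l) ∎)
  where open ≤-Reasoning

cut-of-size-3-profile :
  ∀ n k {a b : ℕ → Bool} → Periodic n a → Periodic n b → 4 ≤ n → weight n a + weight n b ≡ n →
  distance n a (rotate 1 a) + (distance n a b + distance n b (rotate k b)) ≡ 3 →
  distance n a (rotate 1 a) ≡ 2 × distance n a b ≡ 1 × distance n b (rotate k b) ≡ 0
cut-of-size-3-profile n k {a} {b} pa pb 4≤n weights≡n cut≡3 =
  even-even-cut-of-size-3 _ _ _ (distance-rotate-even n 1 pa) (distance-rotate-even n k pb) outer-not-constant cut≡3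
  where
  spokes<n : distance n a b < n
  spokes<n = begin-strict
    distance n a b                             ≤⟨ m≤m+n _ _ ⟩
    distance n a b + distance n b (rotate k b) ≤⟨ m≤n+m _ (distance n a (rotate 1 a)) ⟩
    _                                          ≡⟨ cut≡3 ⟩
    3                                          <⟨ 4≤n ⟩
    n                                          ∎
    where open ≤-Reasoning
  outer-not-constant : distance n a (rotate 1 a) ≢ 0
  outer-not-constant a-constant = <-irrefl
    (constant⇒distance≡n n a b (a 0) (distance-rotate-1≡0⇒constant n a a-constant) weights≡n) spokes<n

no-cut-with-profile-2-1-0 :
  ∀ n k {{_ : NonZero n}} {a b : ℕ → Bool} → Periodic n a → Periodic n b → 4 ≤ n → 1 ≤ k → 2 * k < n →
  weight n a + weight n b ≡ n →
  distance n a (rotate 1 a) ≡ 2 × distance n a b ≡ 1 × distance n b (rotate k b) ≡ 0 → ⊥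
no-cut-with-profile-2-1-0 n k {a} {b} pa pb 4≤n 1≤k 2k<n weights≡n (outer≡2 , spokes≡1 , inner≡0) =
  k*t≢n*l n k (distance n b (rotate 1 b)) (distance k b (rotate 1 b)) 1≤k 2k<n n-odd
          (distance-rotate-even n 1 pb) inner-not-constant inner-changes≤4
          (∑-two-periods n k (mismatch-periodic pb (rotate-periodic 1 pb))
                             (mismatch-periodic inner-k-periodic (rotate-periodic 1 inner-k-periodic)))
  where
  open ≤-Reasoning
  inner-k-periodic : Periodic k b
  inner-k-periodic =
    periodic-≗ (rotate-periodic k pb) pb (λ j<n → sym (distance≡0⇒≡ n b (rotate k b) inner≡0 j<n))
  n-odd : ¬ 2 ∣ n
  n-odd 2∣n = 2∤1 (∣m+n∣m⇒∣n (subst (2 ∣_) n≡2c+1 2∣n) (m∣m*n (common n a b)))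
    where
    n≡2c+1 : n ≡ 2 * common n a b + 1
    n≡2c+1 = trans (sym weights≡n) (trans (sym (distance+2*common n a b))
                   (trans (cong (_+ 2 * common n a b) spokes≡1) (+-comm 1 _)))
  inner-not-constant : 0 < distance n b (rotate 1 b)
  inner-not-constant = n≢0⇒n>0 λ b-constant → <-irrefl
    (trans (sym spokes≡1) (trans (distance-sym n a b)
      (constant⇒distance≡n n b a (b 0) (distance-rotate-1≡0⇒constant n b b-constant)
                         (trans (+-comm (weight n b) (weight n a)) weights≡n))))
    (≤-trans (s≤s (s≤s z≤n)) 4≤n)
  inner-changes≤4 : distance n b (rotate 1 b) ≤ 4
  inner-changes≤4 = begin
    distance n b (rotate 1 b)
      ≤⟨ distance-triangle n b a _ ⟩
    distance n b a + distance n a (rotate 1 b)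
      ≤⟨ +-monoʳ-≤ (distance n b a) (distance-triangle n a (rotate 1 a) _) ⟩
    distance n b a + (distance n a (rotate 1 a) + distance n (rotate 1 a) (rotate 1 b))
      ≡⟨ cong₂ _+_ (trans (distance-sym n b a) spokes≡1)
                   (cong₂ _+_ outer≡2 (trans (distance-rotate n 1 pa pb) spokes≡1)) ⟩
    4
      ∎

module PetersenSubset (n : ℕ) {{_ : NonZero n}} (k : ℕ) (A : Subset n) where

  index : ℕ → Fin n
  index j = fromℕ< (m%n<n j n)

  index-toℕ : ∀ i → index (toℕ i) ≡ i
  index-toℕ i = trans (fromℕ<-cong _ _ (m<n⇒m%n≡m (toℕ<n i)) _ (toℕ<n i)) (fromℕ<-toℕ i (toℕ<n i))

  ⊕≡index : ∀ i m → i ⊕ m ≡ index (m + toℕ i)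
  ⊕≡index i m = fromℕ<-cong _ _ (cong (_% n) (+-comm (toℕ i) m)) _ _

  index-periodic : Periodic n index
  index-periodic j = fromℕ<-cong _ _ (trans (cong (_% n) (+-comm n j)) ([m+n]%n≡m%n j n)) _ _

  outer inner : ℕ → Bool
  outer j = A (u (index j))
  inner j = A (v (index j))

  outer-periodic : Periodic n outer
  outer-periodic = cong (A ∘ u) ∘ index-periodic

  inner-periodic : Periodic n inner
  inner-periodic = cong (A ∘ v) ∘ index-periodic

  card≡weights : card A ≡ weight n outer + weight n inner
  card≡weights = trans (count-++ A (map u (allFin n)) _) (cong₂ _+_ (side u) (side v))
    where
    side : (w : Fin n → Vertex n) → count A (map w (allFin n)) ≡ ∑[ j < n ] bit (A (w (index j)))
    side w = trans (cong (count A) (map-tabulate id w))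
                   (count-tabulate A n w _ (λ i → cong (bit ∘ A ∘ w) (sym (index-toℕ i))))

  cutSize≡distances : cutSize n k A ≡
    distance n outer (rotate 1 outer) + (distance n outer inner + distance n inner (rotate k inner))
  cutSize≡distances = begin
    cutSize n k A
      ≡⟨ cong (count cut ∘ concat) (map-tabulate id star) ⟩
    count cut (concat (tabulate star))
      ≡⟨ count-concat-tabulate cut n star _ star-cut ⟩
    ∑[ j < n ] (outer-cut j + (spoke-cut j + inner-cut j))
      ≡⟨ trans (∑-distrib-+ n outer-cut _) (cong (∑ n outer-cut +_) (∑-distrib-+ n spoke-cut inner-cut)) ⟩
    distance n outer (rotate 1 outer) + (distance n outer inner + distance n inner (rotate k inner)) ∎
    where
    open ≡-Reasoning
    cut : Vertex n × Vertex n → Bool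
    cut e = A (proj₁ e) xor A (proj₂ e)
    star : Fin n → List (Vertex n × Vertex n)
    star i = (u i , u (i ⊕ 1)) ∷ (u i , v i) ∷ (v i , v (i ⊕ k)) ∷ []
    outer-cut spoke-cut inner-cut : ℕ → ℕ
    outer-cut j = bit (outer j xor outer (1 + j))
    spoke-cut j = bit (outer j xor inner j)
    inner-cut j = bit (inner j xor inner (k + j))
    cuts-at : Fin n → ℕ
    cuts-at i = bit (cut (u i , u (i ⊕ 1))) + (bit (cut (u i , v i)) + bit (cut (v i , v (i ⊕ k))))
    cuts-at-index : ∀ i → cuts-at i ≡ outer-cut (toℕ i) + (spoke-cut (toℕ i) + inner-cut (toℕ i))
    cuts-at-index i rewrite ⊕≡index i 1 | ⊕≡index i k | index-toℕ i = refl
    star-cut : ∀ i → count cut (star i) ≡ outer-cut (toℕ i) + (spoke-cut (toℕ i) + inner-cut (toℕ i))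
    star-cut i = trans (count≡sum cut (star i))
      (trans (cong ((bit (cut (u i , u (i ⊕ 1))) +_) ∘ (bit (cut (u i , v i)) +_))
                   (+-identityʳ (bit (cut (v i , v (i ⊕ k))))))
             (cuts-at-index i))

lemma3p3 : (n k : ℕ) → {{_ : NonZero n}} → 4 ≤ n → 1 ≤ k → 2 * k < n →
    (A : Subset n) → ¬ (card A ≡ n × cutSize n k A ≡ 3)
lemma3p3 n k 4≤n 1≤k 2k<n A (card≡n , cut≡3) =
  no-cut-with-profile-2-1-0 n k outer-periodic inner-periodic 4≤n 1≤k 2k<n weights≡n
    (cut-of-size-3-profile n k outer-periodic inner-periodic 4≤n weights≡n
       (trans (sym cutSize≡distances) cut≡3))
  where
  open PetersenSubset n k A
  weights≡n : weight n outer + weight n inner ≡ n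
  weights≡n = trans (sym card≡weights) card≡n
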